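{- Let $k \ge 1$ be an integer and let $A: X \times Y \rightarrow \{0,1,\ldots,k\}$ be a matrix with $\mathrm{Vdim}(A) = 1$. Then $\mathrm{Pdim}^*(A) \le k+2$.
   Context: A matrix is a function $A: X \times Y \rightarrow Z$ with $Z \subseteq \mathbb{R}$ (rows indexed by $X$, columns by $Y$). A set $J \subseteq Y$ is P-shattered by $A$ if there is $\vec t: J \rightarrow \mathbb{R}$ such that for every $b: J \rightarrow \{0,1\}$ there is $x \in X$ with, for all $y \in J$, $A(x,y) \ge \vec t(y)$ iff $b(y)=1$. $J$ is V-shattered by $A$ if the same holds with a single number $t \in \mathbb{R}$ used for all $y\in J$ in place of $\vec t(y)$. $\mathrm{Pdim}(A)$ (resp. $\mathrm{Vdim}(A)$) is the largest size of a P-shattered (resp. V-shattered) set $J\subseteq Y$, or $\infty$ if such sets of unbounded size exist. The transpose $A^\top: Y \times X \rightarrow Z$ is $A^\top(y,x) = A(x,y)$, and the dual dimension is $\mathrm{Pdim}^*(A) := \mathrm{Pdim}(A^\top)$. -}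

module Defs where

open import Data.Nat using (ℕ; _≤_)
open import Data.Bool using (Bool; true)
open import Data.Fin using (Fin)
open import Data.Product using (Σ; ∃; _×_)
open import Function.Definitions using (Injective)
open import Function.Bundles using (_⇔_)
open import Relation.Binary.PropositionalEquality using (_≡_)

-- Thresholds are taken in ℕ: since all entries are natural numbers,
-- a real threshold t can be replaced by max(0, ⌈t⌉) without changing
-- any comparison A(x,y) ≥ t.

Matrix : Set → Set → Set
Matrix X Y = X → Y → ℕ

transpose : {X Y : Set} → Matrix X Y → Matrix Y X
transpose A y x = A x y

-- A finite set J ⊆ Y of size n is given by an injective map Fin n → Y.

PShattered : {X Y : Set} → Matrix X Y → (n : ℕ) → (Fin n → Y) → Set
PShattered {X} A n J =
  Σ (Fin n → ℕ) λ t → (b : Fin n → Bool) →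
    Σ X λ x → (i : Fin n) → (t i ≤ A x (J i)) ⇔ (b i ≡ true)

VShattered : {X Y : Set} → Matrix X Y → (n : ℕ) → (Fin n → Y) → Set
VShattered {X} A n J =
  Σ ℕ λ t → (b : Fin n → Bool) →
    Σ X λ x → (i : Fin n) → (t ≤ A x (J i)) ⇔ (b i ≡ true)

PdimAtMost : {X Y : Set} → Matrix X Y → ℕ → Set
PdimAtMost {Y = Y} A d =
  (n : ℕ) (J : Fin n → Y) → Injective _≡_ _≡_ J → PShattered A n J → n ≤ d

VdimEq : {X Y : Set} → Matrix X Y → ℕ → Set
VdimEq {Y = Y} A d =
  (Σ (Fin d → Y) λ J → Injective _≡_ _≡_ J × VShattered A d J) ×
  ((n : ℕ) (J : Fin n → Y) → Injective _≡_ _≡_ J → VShattered A n J → n ≤ d)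

PdimDualAtMost : {X Y : Set} → Matrix X Y → ℕ → Set
PdimDualAtMost A d = PdimAtMost (transpose A) d

-- Only the upper bound Vdim(A) ≤ 1 is used. The dual P-shattering thresholds of
-- rows R₁,…,Rₙ lie in {1,…,k}: the all-false column forces tᵢ ≥ 1, the all-true
-- column forces tᵢ ≤ k. Take a row a of least threshold and a row c of greatest
-- threshold among the others. If n ≥ k + 3, the remaining n − 2 ≥ k + 1 rows have
-- two rows i, j with a common threshold T. The columns realising the patterns
-- {i, c} and {j, c} are then V-shattered at T by the rows c, i, j, a, so Vdim(A) ≥ 2.
module Submission where

open import Defs
open import Data.Nat using (ℕ; suc; _≤_; _<_; _+_; _∸_; z≤n; s≤s)
open import Data.Nat.Properties
  using (≤-trans; ≤-totalPreorder; ≮⇒≥; +-comm; n≢0⇒n>0; ∸-monoˡ-<; ∸-cancelʳ-≡; m+n∸m≡n)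
open import Data.Fin using (Fin; zero; suc; toℕ; fromℕ<; punchIn; _≟_)
open import Data.Fin.Properties
  using (pigeonhole; fromℕ<-injective; <⇒≢; toℕ≤pred[n]; punchInᵢ≢i; punchIn-injective)
open import Data.Vec.Functional using ([]; _∷_)
open import Data.Bool using (Bool; true; false; _∨_)
open import Data.Bool.Properties using (∨-zeroʳ)
open import Data.Product using (Σ; ∃; ∃₂; _×_; _,_; proj₁; proj₂)
open import Data.Sum using (inj₁; inj₂)
open import Data.Empty using (⊥-elim)
open import Function using (_∘_; const)
open import Function.Definitions using (Injective)
open import Function.Bundles using (_⇔_; mk⇔; Equivalence)
open import Relation.Binary using (TotalPreorder)
import Relation.Binary.Construct.Flip.EqAndOrd as Flip
open import Relation.Nullary using (¬_; does)
open import Relation.Nullary.Decidable using (dec-true; dec-false)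
open import Relation.Binary.PropositionalEquality
  using (_≡_; _≢_; refl; sym; trans; cong; cong₂; subst)

open Equivalence using (to; from)

argmin : ∀ {c ℓ₁ ℓ₂} (O : TotalPreorder c ℓ₁ ℓ₂) {m : ℕ} →
         let open TotalPreorder O in
         (f : Fin (suc m) → Carrier) → ∃ λ i → ∀ j → f i ≲ f j
argmin O {0} f = zero , λ { zero → TotalPreorder.refl O }
argmin O {suc m} f with i , f[i]-least ← argmin O (f ∘ suc)
                  with TotalPreorder.total O (f zero) (f (suc i))
... | inj₁ f₀≲ = zero , λ { zero → TotalPreorder.refl O
                          ; (suc j) → TotalPreorder.trans O f₀≲ (f[i]-least j) }
... | inj₂ ≲f₀ = suc i , λ { zero → ≲f₀ ; (suc j) → f[i]-least j }

pigeonhole-interval : ∀ {m} lo k → k < m → (f : Fin m → ℕ) →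
                      (∀ x → lo ≤ f x) → (∀ x → f x < lo + k) →
                      ∃₂ λ x y → x ≢ y × f x ≡ f y
pigeonhole-interval lo k k<m f lo≤f f<lo+k =
  let x , y , x<y , eq = pigeonhole k<m (λ x → fromℕ< (shifted< x))
  in x , y , <⇒≢ x<y , ∸-cancelʳ-≡ (lo≤f x) (lo≤f y) (fromℕ<-injective _ _ _ _ eq)
  where
  shifted< : ∀ x → f x ∸ lo < k
  shifted< x = subst (f x ∸ lo <_) (m+n∸m≡n lo k) (∸-monoˡ-< (f<lo+k x) (lo≤f x))

pairIndicator : ∀ {n} → Fin n → Fin n → Fin n → Bool
pairIndicator p q x = does (x ≟ p) ∨ does (x ≟ q)

module _ {n : ℕ} (p q : Fin n) where

  pairIndicator-first : pairIndicator p q p ≡ true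
  pairIndicator-first = cong (_∨ does (p ≟ q)) (dec-true (p ≟ p) refl)

  pairIndicator-second : pairIndicator p q q ≡ true
  pairIndicator-second = trans (cong (does (q ≟ p) ∨_) (dec-true (q ≟ q) refl)) (∨-zeroʳ _)

  pairIndicator-outside : ∀ {x} → x ≢ p → x ≢ q → pairIndicator p q x ≡ false
  pairIndicator-outside x≢p x≢q = cong₂ _∨_ (dec-false (_ ≟ p) x≢p) (dec-false (_ ≟ q) x≢q)

VShattered-pair : {X Y : Set} {A : Matrix X Y} (T : ℕ) (y₁ y₂ : Y) →
                  ((u v : Bool) → Σ X λ x →
                    ((T ≤ A x y₁) ⇔ (u ≡ true)) × ((T ≤ A x y₂) ⇔ (v ≡ true))) →
                  Injective _≡_ _≡_ (y₁ ∷ y₂ ∷ []) × VShattered A 2 (y₁ ∷ y₂ ∷ [])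
VShattered-pair {A = A} T y₁ y₂ row = injective , T , shatter
  where
  y₁≢y₂ : y₁ ≢ y₂
  y₁≢y₂ y₁≡y₂ with x , x-y₁ , x-y₂ ← row true false
    with () ← to x-y₂ (subst (λ y → T ≤ A x y) y₁≡y₂ (from x-y₁ refl))

  injective : Injective _≡_ _≡_ (y₁ ∷ y₂ ∷ [])
  injective {zero}     {zero}     _  = refl
  injective {zero}     {suc zero} eq with () ← y₁≢y₂ eq
  injective {suc zero} {zero}     eq with () ← y₁≢y₂ (sym eq)
  injective {suc zero} {suc zero} _  = refl

  shatter : (b : Fin 2 → Bool) → Σ _ λ x → (i : Fin 2) →
            (T ≤ A x ((y₁ ∷ y₂ ∷ []) i)) ⇔ (b i ≡ true)
  shatter b with x , x-y₁ , x-y₂ ← row (b zero) (b (suc zero))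
    = x , λ { zero → x-y₁ ; (suc zero) → x-y₂ }

module DualShattering {X Y : Set} {A : Matrix X Y} {n : ℕ} {R : Fin n → X}
                      (shattered : PShattered (transpose A) n R) where

  threshold : Fin n → ℕ
  threshold = proj₁ shattered

  column : (Fin n → Bool) → Y
  column b = proj₁ (proj₂ shattered b)

  column-realises : ∀ b i → (threshold i ≤ A (R i) (column b)) ⇔ (b i ≡ true)
  column-realises b = proj₂ (proj₂ shattered b)

  column-above : ∀ {b i} → b i ≡ true → threshold i ≤ A (R i) (column b)
  column-above {b} {i} = from (column-realises b i)

  column-below : ∀ {b i} → b i ≡ false → ¬ threshold i ≤ A (R i) (column b)
  column-below {b} {i} bᵢ≡false above with () ← trans (sym bᵢ≡false) (to (column-realises b i) above)

  threshold-positive : ∀ i → 1 ≤ threshold i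
  threshold-positive i = n≢0⇒n>0 λ tᵢ≡0 →
    column-below {const false} refl (subst (_≤ A (R i) _) (sym tᵢ≡0) z≤n)

  threshold-bounded : ∀ {k} → (∀ x y → A x y ≤ k) → ∀ i → threshold i ≤ k
  threshold-bounded A≤k i = ≤-trans (column-above {const true} refl) (A≤k _ _)

  VShattered-from-equal-thresholds :
    ∀ {a i j c} → i ≢ j → i ≢ c → j ≢ c → a ≢ i → a ≢ j → a ≢ c →
    threshold a ≤ threshold i → threshold i ≡ threshold j → threshold i ≤ threshold c →
    Σ (Fin 2 → Y) λ J → Injective _≡_ _≡_ J × VShattered A 2 J
  VShattered-from-equal-thresholds {a} {i} {j} {c} i≢j i≢c j≢c a≢i a≢j a≢c tₐ≤tᵢ tᵢ≡tⱼ tᵢ≤t꜀ =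
    _ , VShattered-pair {A = A} T y₁ y₂ row
    where
    T : ℕ
    T = threshold i

    y₁ y₂ : Y
    y₁ = column (pairIndicator i c)
    y₂ = column (pairIndicator j c)

    holds : ∀ {P : Set} → P → P ⇔ (true ≡ true)
    holds p = mk⇔ (λ _ → refl) (λ _ → p)

    fails : ∀ {P : Set} → ¬ P → P ⇔ (false ≡ true)
    fails ¬p = mk⇔ (⊥-elim ∘ ¬p) (λ ())

    below-a : ∀ {p} → a ≢ p → ¬ T ≤ A (R a) (column (pairIndicator p c))
    below-a a≢p = column-below (pairIndicator-outside _ c a≢p a≢c) ∘ ≤-trans tₐ≤tᵢ

    row : (u v : Bool) → Σ X λ x → ((T ≤ A x y₁) ⇔ (u ≡ true)) × ((T ≤ A x y₂) ⇔ (v ≡ true))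
    row true  true  = R c , holds (≤-trans tᵢ≤t꜀ (column-above (pairIndicator-second i c)))
                          , holds (≤-trans tᵢ≤t꜀ (column-above (pairIndicator-second j c)))
    row true  false = R i , holds (column-above (pairIndicator-first i c))
                          , fails (column-below (pairIndicator-outside j c i≢j i≢c))
    row false true  = R j , fails (column-below (pairIndicator-outside i c (i≢j ∘ sym) j≢c)
                                   ∘ subst (_≤ _) tᵢ≡tⱼ)
                          , holds (subst (_≤ _) (sym tᵢ≡tⱼ) (column-above (pairIndicator-first j c)))
    row false false = R a , fails (below-a a≢i) , fails (below-a a≢j)

PShattered-transpose⇒VShattered-pair :
  ∀ {k n} {X Y : Set} {A : Matrix X Y} {R : Fin n → X} →
  (∀ x y → A x y ≤ k) → 2 + k < n → PShattered (transpose A) n R →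
  Σ (Fin 2 → Y) λ J → Injective _≡_ _≡_ J × VShattered A 2 J
PShattered-transpose⇒VShattered-pair {k} {A = A} {R} A≤k (s≤s (s≤s k<m)) shattered =
  let x , y , x≢y , tᵢ≡tⱼ = pigeonhole-interval 1 k k<m (threshold ∘ others)
                              (threshold-positive ∘ others) (s≤s ∘ threshold-bounded A≤k ∘ others)
  in VShattered-from-equal-thresholds
       (x≢y ∘ others-injective) (other≢c x) (other≢c y) (other≢a x ∘ sym) (other≢a y ∘ sym)
       (punchInᵢ≢i a c′ ∘ sym) (tₐ-least (others x)) tᵢ≡tⱼ (t꜀-greatest (punchIn c′ x))
  where
  open DualShattering {A = A} {R = R} shattered

  a : Fin _
  a = proj₁ (argmin ≤-totalPreorder threshold)

  tₐ-least : ∀ i → threshold a ≤ threshold i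
  tₐ-least = proj₂ (argmin ≤-totalPreorder threshold)

  -- Indexing through punchIn keeps c ≠ a, and the remaining rows apart from both, by construction.
  c′ : Fin _
  c′ = proj₁ (argmin (Flip.totalPreorder ≤-totalPreorder) (threshold ∘ punchIn a))

  t꜀-greatest : ∀ i → threshold (punchIn a i) ≤ threshold (punchIn a c′)
  t꜀-greatest = proj₂ (argmin (Flip.totalPreorder ≤-totalPreorder) (threshold ∘ punchIn a))

  others : Fin _ → Fin _
  others = punchIn a ∘ punchIn c′

  others-injective : ∀ {x y} → others x ≡ others y → x ≡ y
  others-injective = punchIn-injective c′ _ _ ∘ punchIn-injective a _ _

  other≢a : ∀ x → others x ≢ a
  other≢a x = punchInᵢ≢i a (punchIn c′ x)

  other≢c : ∀ x → others x ≢ punchIn a c′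
  other≢c x = punchInᵢ≢i c′ x ∘ punchIn-injective a _ _

theorem6 : (k : ℕ) → 1 ≤ k → {X Y : Set} → (A : X → Y → Fin (suc k)) →
    VdimEq (λ x y → toℕ (A x y)) 1 →
    PdimDualAtMost (λ x y → toℕ (A x y)) (k + 2)
theorem6 k _ A (_ , Vdim≤1) n R _ shattered = ≮⇒≥ λ k+2<n →
  let J , J-injective , J-shattered =
        PShattered-transpose⇒VShattered-pair (λ x y → toℕ≤pred[n] (A x y))
          (subst (_< n) (+-comm k 2) k+2<n) shattered
  in 2≰1 (Vdim≤1 2 J J-injective J-shattered)
  where
  2≰1 : ¬ 2 ≤ 1
  2≰1 (s≤s ())
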